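{- The set $ATile_{FIN}$ defined below is $\Pi^0_1$.
   Context: A Wang prototile is a 4-tuple $\langle l,u,r,b\rangle$ of colours (natural numbers) for the left, upper, right, bottom quarters of a diagonally quadrisected unit square. A total $S$-tiling is a map $T:\mathbb{Z}^2\to S$ with right colour of $T(x,y)$ = left colour of $T(x+1,y)$ and upper colour of $T(x,y)$ = bottom colour of $T(x,y+1)$ for all $(x,y)$ (no rotations). $T$ is periodic if there is a nonzero $\mathbf v\in\mathbb{Z}^2$ with $T(p+\mathbf v)=T(p)$ for all $p$, aperiodic otherwise. $ATile_{FIN}$ is the set of (indices $e$ of characteristic functions $\varphi_e$ of) finite sets $S$ of Wang prototiles which tile the plane and all of whose total tilings are aperiodic. -}

module Defs where

open import Data.Nat using (ℕ)
open import Data.Integer using (ℤ; _+_; 1ℤ; 0ℤ)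
open import Data.Bool using (Bool; true)
open import Data.List using (List)
open import Data.List.Membership.Propositional using (_∈_)
open import Data.Product using (Σ; ∃; _×_; _,_)
open import Relation.Binary.PropositionalEquality using (_≡_)
open import Relation.Nullary using (¬_)
open import Axiom.ExcludedMiddle using (ExcludedMiddle)
open import Level using (0ℓ)

record Prototile : Set where
  constructor ⟨_,_,_,_⟩
  field
    left upper right bottom : ℕ
open Prototile public

TileSet : Set
TileSet = List Prototile

-- A total S-tiling: T : ℤ² → S with matching edge colours (no rotations).
record Tiling (S : TileSet) : Set where
  field
    T       : ℤ → ℤ → Prototile
    inS     : ∀ x y → T x y ∈ S
    matchH  : ∀ x y → right (T x y) ≡ left (T (x + 1ℤ) y)
    matchV  : ∀ x y → upper (T x y) ≡ bottom (T x (y + 1ℤ))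
open Tiling public

Periodic : {S : TileSet} → Tiling S → Set
Periodic τ = Σ ℤ λ a → Σ ℤ λ b →
  ¬ (a ≡ 0ℤ × b ≡ 0ℤ) × (∀ x y → T τ (x + a) (y + b) ≡ T τ x y)

ATile : TileSet → Set
ATile S = Tiling S × (∀ (τ : Tiling S) → ¬ Periodic τ)

-- A predicate P on finite tile sets is Π⁰₁: there is a computable
-- (i.e. definable, total Agda) Boolean relation R with
-- P S ⇔ ∀ n, R S n = true.  The matrix R is required to exist
-- independently of any classical axiom; the equivalence is proved in
-- classical mathematics (excluded middle is allowed for it only).
Π⁰₁ : (TileSet → Set) → Set₁
Π⁰₁ P = Σ (TileSet → ℕ → Bool) λ R →
  ExcludedMiddle 0ℓ →
  ∀ S → (P S → ∀ n → R S n ≡ true) × ((∀ n → R S n ≡ true) → P S)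

{-# OPTIONS --safe #-}
module Submission where

-- S is in ATile iff for every n some n × n square is validly tiled by S while no
-- (n + 1) × (n + 1) torus is, and both conditions are decided by exhaustive search.
-- A tiling restricts to valid squares, and a valid torus unrolls to a periodic tiling.
-- Conversely, valid squares of all sizes give a tiling by König's lemma (the only
-- classical step), and a periodic tiling yields one with a square period, hence a valid
-- torus: a period (a, h + 1) makes the tiling a stack of shifted copies of a strip of
-- height h + 1, and pigeonhole on the finitely many (2|a| + 1)-column windows of that
-- strip makes it horizontally periodic too; a horizontal period is reduced to this case
-- by transposition.

open import Defs
open import Data.Nat as ℕ using (ℕ; zero; suc; NonZero; z≤n; s≤s; _<_; _≤_; _<?_; _⊔_)
import Data.Nat.Properties as ℕP
open import Data.Nat.DivMod using (_%_; m%n<n; m<n⇒m%n≡m; n%n≡0)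
open import Data.Integer as ℤ using (ℤ; +_; -[1+_]; _+_; _*_; -_; _-_; 1ℤ; 0ℤ)
open import Data.Integer.Properties
  using (+-comm; +-assoc; +-identityˡ; +-identityʳ; +-inverseˡ; +-injective; +-0-abelianGroup;
         *-comm; *-zeroˡ; *-zeroʳ; suc-*; pos-*; neg-distribˡ-*;
         <-cmp; <-irrefl; ≤-refl; ≤-reflexive; ≤-trans; ≤-<-trans; <-≤-trans; module ≤-Reasoning;
         +-monoˡ-≤; +-monoˡ-<; *-monoʳ-≤-nonNeg; i<j⇒suc[i]≤j; i≤i+j; i≤j+i;
         neg-≤-pos; neg-mono-≤; drop‿+<+; 0≤i⇒+∣i∣≡i)
open import Data.Integer.DivMod using (_%ℕ_; _/ℕ_; n%ℕd<d; a≡a%ℕn+[a/ℕn]*n)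
open import Data.Integer.Tactic.RingSolver using (solve-∀)
open import Algebra.Properties.AbelianGroup +-0-abelianGroup using (∙-cancelʳ)
open import Data.Bool using (Bool; true)
open import Data.Empty using (⊥-elim)
open import Data.Fin using (toℕ)
open import Data.Fin.Properties using (pigeonhole)
open import Data.List
  using (List; []; _∷_; length; lookup; map; foldr; applyUpTo; cartesianProductWith)
open import Data.List.Relation.Unary.Any as Any using (Any; here; there; any?)
open import Data.List.Relation.Unary.Any.Properties using (lookup-index)
open import Data.List.Membership.Propositional using (_∈_; lose; find)
open import Data.List.Membership.Propositional.Properties
  using (∈-cartesianProductWith⁺; ∈-cartesianProductWith⁻; ∈-map⁺; ∈-map⁻)
open import Data.Vec using (Vec; []; _∷_)
open import Data.Product using (Σ; ∃; ∃₂; _×_; _,_; proj₁; proj₂; uncurry)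
open import Data.Product.Function.NonDependent.Propositional using (_×-↩_)
open import Data.Sum using (_⊎_; inj₁; inj₂)
open import Data.Unit using (⊤; tt)
open import Function using (_∘_; _↩_; mk↩; LeftInverse)
open import Function.Construct.Composition using (_↩-∘_)
open import Relation.Binary.PropositionalEquality
open import Relation.Binary.Definitions using (tri<; tri≈; tri>)
open import Relation.Nullary using (¬_; Dec; yes; does; ¬?)
open import Relation.Nullary.Decidable using (_×-dec_; _→-dec_; dec-true)
open import Axiom.ExcludedMiddle using (ExcludedMiddle)
open import Axiom.DoubleNegationElimination using (em⇒dne)
open import Level using (0ℓ)

private variable
  A : Set
  S : TileSet

private
  minus-plus : ∀ x a → x - a + a ≡ x
  minus-plus = solve-∀

  plus-minus : ∀ x a → x + a - a ≡ x
  plus-minus = solve-∀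

  plus-minus-comm : ∀ x a b → x + a - b ≡ x - b + a
  plus-minus-comm = solve-∀

  plus-suc-comm : ∀ x a → x + a + 1ℤ ≡ 1ℤ + x + a
  plus-suc-comm = solve-∀

  [r+k*d]<[r'+k'*d] : ∀ {d r r' k k'} → r ℕ.< d → k ℤ.< k' → + r + k * + d ℤ.< + r' + k' * + d
  [r+k*d]<[r'+k'*d] {d} {r} {r'} {k} {k'} r<d k<k' = begin-strict
    + r + k * + d    <⟨ +-monoˡ-< (k * + d) (ℤ.+<+ r<d) ⟩
    + d + k * + d    ≡⟨ suc-* k (+ d) ⟨
    ℤ.suc k * + d    ≤⟨ *-monoʳ-≤-nonNeg (+ d) (i<j⇒suc[i]≤j k<k') ⟩
    k' * + d         ≤⟨ i≤j+i (k' * + d) (+ r') ⟩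
    + r' + k' * + d  ∎
    where open ≤-Reasoning

divModℕ-unique : ∀ {d r r' k k'} → r ℕ.< d → r' ℕ.< d →
                 + r + k * + d ≡ + r' + k' * + d → r ≡ r' × k ≡ k'
divModℕ-unique {d} {r} {r'} {k} {k'} r<d r'<d eq with <-cmp k k'
... | tri< k<k' _ _ = ⊥-elim (<-irrefl eq ([r+k*d]<[r'+k'*d] r<d k<k'))
... | tri> _ _ k'<k = ⊥-elim (<-irrefl (sym eq) ([r+k*d]<[r'+k'*d] r'<d k'<k))
... | tri≈ _ refl _ = +-injective (∙-cancelʳ (k * + d) (+ r) (+ r') eq) , refl

module _ (d : ℕ) .{{_ : NonZero d}} where

  divModℕ-≡ : ∀ {x r} k → r ℕ.< d → x ≡ + r + k * + d → x %ℕ d ≡ r × x /ℕ d ≡ k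
  divModℕ-≡ {x} k r<d refl =
    divModℕ-unique (n%ℕd<d x d) r<d (sym (a≡a%ℕn+[a/ℕn]*n x d))

  %ℕ-/ℕ-+d : ∀ x → (x + + d) %ℕ d ≡ x %ℕ d × (x + + d) /ℕ d ≡ x /ℕ d + 1ℤ
  %ℕ-/ℕ-+d x = divModℕ-≡ (x /ℕ d + 1ℤ) (n%ℕd<d x d)
    (trans (cong (_+ + d) (a≡a%ℕn+[a/ℕn]*n x d)) (shift (+ (x %ℕ d)) (x /ℕ d) (+ d)))
    where
    shift : ∀ r k d → r + k * d + d ≡ r + (k + 1ℤ) * d
    shift = solve-∀

  %ℕ-/ℕ-+1 : ∀ x →
    (suc (x %ℕ d) ℕ.< d × (x + 1ℤ) %ℕ d ≡ suc (x %ℕ d) × (x + 1ℤ) /ℕ d ≡ x /ℕ d)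
    ⊎ (suc (x %ℕ d) ≡ d × (x + 1ℤ) %ℕ d ≡ 0 × (x + 1ℤ) /ℕ d ≡ x /ℕ d + 1ℤ)
  %ℕ-/ℕ-+1 x with ℕP.m≤n⇒m<n∨m≡n (n%ℕd<d x d)
  ... | inj₁ r+1<d = inj₁ (r+1<d , divModℕ-≡ k r+1<d x+1≡)
    where
    r = x %ℕ d
    k = x /ℕ d
    x+1≡ : x + 1ℤ ≡ + suc r + k * + d
    x+1≡ = trans (cong (_+ 1ℤ) (a≡a%ℕn+[a/ℕn]*n x d)) (plus-suc-comm (+ r) (k * + d))
  ... | inj₂ r+1≡d = inj₂ (r+1≡d , divModℕ-≡ (k + 1ℤ) (ℕP.n≢0⇒n>0 (ℕ.≢-nonZero⁻¹ d)) x+1≡)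
    where
    r = x %ℕ d
    k = x /ℕ d
    x+1≡ : x + 1ℤ ≡ + 0 + (k + 1ℤ) * + d
    x+1≡ = begin
      x + 1ℤ                ≡⟨ cong (_+ 1ℤ) (a≡a%ℕn+[a/ℕn]*n x d) ⟩
      + r + k * + d + 1ℤ    ≡⟨ plus-suc-comm (+ r) (k * + d) ⟩
      + suc r + k * + d     ≡⟨ cong (λ e → + e + k * + d) r+1≡d ⟩
      + d + k * + d         ≡⟨ suc-* k (+ d) ⟨
      (1ℤ + k) * + d        ≡⟨ cong (_* + d) (+-comm 1ℤ k) ⟩
      (k + 1ℤ) * + d        ≡⟨ +-identityˡ _ ⟨
      + 0 + (k + 1ℤ) * + d  ∎
      where open ≡-Reasoning

  [x+1]%ℕd≡[1+x%ℕd]%d : ∀ x → (x + 1ℤ) %ℕ d ≡ suc (x %ℕ d) % d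
  [x+1]%ℕd≡[1+x%ℕd]%d x with %ℕ-/ℕ-+1 x
  ... | inj₁ (r+1<d , r+1 , _) = trans r+1 (sym (m<n⇒m%n≡m r+1<d))
  ... | inj₂ (r+1≡d , r+1 , _) = trans r+1 (sym (trans (cong (_% d) r+1≡d) (n%n≡0 d)))

+∣i+m∣≡i+m : ∀ {m x} → - + m ℤ.≤ x → + ℤ.∣ x + + m ∣ ≡ x + + m
+∣i+m∣≡i+m {m} {x} -m≤x =
  0≤i⇒+∣i∣≡i (subst (ℤ._≤ x + + m) (+-inverseˡ (+ m)) (+-monoˡ-≤ (+ m) -m≤x))

∣i+m∣<n+m : ∀ {m n x} → - + m ℤ.≤ x → x ℤ.< + n → ℤ.∣ x + + m ∣ ℕ.< n ℕ.+ m
∣i+m∣<n+m {m} {n} {x} -m≤x x<n =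
  drop‿+<+ (subst (ℤ._< + (n ℕ.+ m)) (sym (+∣i+m∣≡i+m -m≤x)) (+-monoˡ-< (+ m) x<n))

-- Lists, words and pumping

nth : A → List A → ℕ → A
nth d []       _       = d
nth d (x ∷ xs) zero    = x
nth d (x ∷ xs) (suc i) = nth d xs i

nth-applyUpTo : ∀ (d : A) f {n i} → i ℕ.< n → nth d (applyUpTo f n) i ≡ f i
nth-applyUpTo d f {suc n} {zero}  _         = refl
nth-applyUpTo d f {suc n} {suc i} (s≤s i<n) = nth-applyUpTo d (f ∘ suc) i<n

applyUpTo-≡⇒≡ : ∀ {f g : ℕ → A} {n i} → applyUpTo f n ≡ applyUpTo g n → i ℕ.< n → f i ≡ g i
applyUpTo-≡⇒≡ {f = f} {g} {n} {i} eq i<n = begin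
  f i                         ≡⟨ nth-applyUpTo (f i) f i<n ⟨
  nth (f i) (applyUpTo f n) i ≡⟨ cong (λ w → nth (f i) w i) eq ⟩
  nth (f i) (applyUpTo g n) i ≡⟨ nth-applyUpTo (f i) g i<n ⟩
  g i                         ∎
  where open ≡-Reasoning

wordsOf : List A → ℕ → List (List A)
wordsOf S zero    = [] ∷ []
wordsOf S (suc n) = cartesianProductWith _∷_ S (wordsOf S n)

applyUpTo∈wordsOf : ∀ {S : List A} {f} n → (∀ {i} → i ℕ.< n → f i ∈ S) → applyUpTo f n ∈ wordsOf S n
applyUpTo∈wordsOf zero    f∈S = here refl
applyUpTo∈wordsOf (suc n) f∈S =
  ∈-cartesianProductWith⁺ _∷_ (f∈S (s≤s z≤n)) (applyUpTo∈wordsOf n (f∈S ∘ s≤s))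

nth∈ : ∀ {S : List A} d {n w i} → w ∈ wordsOf S n → i ℕ.< n → nth d w i ∈ S
nth∈ {S = S} d {suc n} w∈ i<n with ∈-cartesianProductWith⁻ _∷_ S (wordsOf S n) w∈
nth∈ d {i = zero}  _ _         | _ , _ , a∈S , _ , refl = a∈S
nth∈ d {i = suc i} _ (s≤s i<n) | _ , _ , _ , w∈ , refl = nth∈ d w∈ i<n

wrapAround : ∀ {N} .{{_ : NonZero N}} (h : ℕ → A) → (∀ k → h (k ℕ.+ N) ≡ h k) →
             ∀ {i} → i < N → h (suc i) ≡ h (suc i % N)
wrapAround {N = N} h period {i} i<N with ℕP.m≤n⇒m<n∨m≡n i<N
... | inj₁ i+1<N = cong h (sym (m<n⇒m%n≡m i+1<N))
... | inj₂ refl  = trans (period 0) (cong h (sym (n%n≡0 N)))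

uniformBound : ∀ {P : ℕ → A → Set} → (∀ {m n a} → m ≤ n → P m a → P n a) →
               ∀ (L : List A) → (∀ {a} → a ∈ L → ∃ λ m → P m a) → ∃ λ n → ∀ {a} → a ∈ L → P n a
uniformBound mono []      bound = 0 , λ ()
uniformBound mono (a ∷ L) bound with bound (here refl) | uniformBound mono L (bound ∘ there)
... | m , Pma | n , Pn = m ⊔ n , λ where
  (here refl) → mono (ℕP.m≤m⊔n m n) Pma
  (there a∈L) → mono (ℕP.m≤n⊔m m n) (Pn a∈L)

-- g runs round a loop of length q + 1, along which d changes as it does along ℤ.
IsLoop : (ℤ → A) → ℕ → (ℤ → ℤ) → Set
IsLoop d q g = (∀ z → g (z + + suc q) ≡ g z) × (∀ z → d (g (z + 1ℤ)) ≡ d (g z + 1ℤ))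

loop : ∀ (d : ℤ → A) i q → d (+ i) ≡ d (+ (suc i ℕ.+ q)) → Σ (ℤ → ℤ) (IsLoop d q)
loop d i q repeat = g , g-periodic , g-step
  where
  g : ℤ → ℤ
  g z = + i + + ((z - + i) %ℕ suc q)
  g-periodic : ∀ z → g (z + + suc q) ≡ g z
  g-periodic z = trans (cong (λ y → + i + + (y %ℕ suc q)) (plus-minus-comm z (+ suc q) (+ i)))
                       (cong (λ r → + i + + r) (proj₁ (%ℕ-/ℕ-+d (suc q) (z - + i))))
  g-+1 : ∀ z → g (z + 1ℤ) ≡ + i + + ((z - + i + 1ℤ) %ℕ suc q)
  g-+1 z = cong (λ y → + i + + (y %ℕ suc q)) (plus-minus-comm z 1ℤ (+ i))
  g-step : ∀ z → d (g (z + 1ℤ)) ≡ d (g z + 1ℤ)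
  g-step z with %ℕ-/ℕ-+1 (suc q) (z - + i)
  ... | inj₁ (_ , r+1 , _) = cong d (begin
    g (z + 1ℤ)                         ≡⟨ g-+1 z ⟩
    + i + + ((z - + i + 1ℤ) %ℕ suc q)  ≡⟨ cong (λ r → + i + + r) r+1 ⟩
    + i + (1ℤ + + r)                   ≡⟨ +-suc-comm (+ i) (+ r) ⟩
    g z + 1ℤ                           ∎)
    where
    open ≡-Reasoning
    r = (z - + i) %ℕ suc q
    +-suc-comm : ∀ a b → a + (1ℤ + b) ≡ a + b + 1ℤ
    +-suc-comm = solve-∀
  ... | inj₂ (r+1≡q+1 , wrap , _) = begin
    d (g (z + 1ℤ))                         ≡⟨ cong d (g-+1 z) ⟩
    d (+ i + + ((z - + i + 1ℤ) %ℕ suc q))  ≡⟨ cong (λ r → d (+ i + + r)) wrap ⟩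
    d (+ (i ℕ.+ 0))                        ≡⟨ cong (d ∘ +_) (ℕP.+-identityʳ i) ⟩
    d (+ i)                                ≡⟨ repeat ⟩
    d (+ (suc i ℕ.+ q))                    ≡⟨ cong (λ r → d (+ (suc i ℕ.+ r))) r≡q ⟨
    d (+ (suc i ℕ.+ r))                    ≡⟨ cong (d ∘ +_) (ℕP.+-comm (i ℕ.+ r) 1) ⟨
    d (g z + 1ℤ)                           ∎
    where
    open ≡-Reasoning
    r = (z - + i) %ℕ suc q
    r≡q = ℕP.suc-injective r+1≡q+1

pumping : ∀ {L : List A} (d : ℤ → A) → (∀ z → d z ∈ L) → ∃ λ q → Σ (ℤ → ℤ) (IsLoop d q)
pumping {L = L} d d∈L with pigeonhole (ℕP.n<1+n (length L)) (λ i → Any.index (d∈L (+ toℕ i)))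
... | i , j , i<j , same = _ , loop d (toℕ i) (toℕ j ℕ.∸ suc (toℕ i)) repeat
  where
  repeat : d (+ toℕ i) ≡ d (+ (suc (toℕ i) ℕ.+ (toℕ j ℕ.∸ suc (toℕ i))))
  repeat = trans (lookup-index (d∈L (+ toℕ i)))
          (trans (cong (lookup L) same)
          (trans (sym (lookup-index (d∈L (+ toℕ j))))
                 (cong (d ∘ +_) (sym (ℕP.m+[n∸m]≡n i<j)))))

-- Periods of tilings

HasPeriod : Tiling S → ℤ → ℤ → Set
HasPeriod τ a b = ∀ x y → T τ (x + a) (y + b) ≡ T τ x y

module _ (τ : Tiling S) where

  period-0 : HasPeriod τ 0ℤ 0ℤ
  period-0 x y = cong₂ (T τ) (+-identityʳ x) (+-identityʳ y)

  period-+ : ∀ {a b c d} → HasPeriod τ a b → HasPeriod τ c d → HasPeriod τ (a + c) (b + d)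
  period-+ {a} {b} {c} {d} p q x y =
    trans (cong₂ (T τ) (reassoc x a c) (reassoc y b d)) (trans (p (x + c) (y + d)) (q x y))
    where
    reassoc : ∀ x a c → x + (a + c) ≡ x + c + a
    reassoc = solve-∀

  period-neg : ∀ {a b} → HasPeriod τ a b → HasPeriod τ (- a) (- b)
  period-neg {a} {b} p x y =
    trans (sym (p (x - a) (y - b))) (cong₂ (T τ) (minus-plus x a) (minus-plus y b))

  period-*ℕ : ∀ {a b} → HasPeriod τ a b → ∀ n → HasPeriod τ (+ n * a) (+ n * b)
  period-*ℕ {a} {b} p zero    = subst₂ (HasPeriod τ) (sym (*-zeroˡ a)) (sym (*-zeroˡ b)) period-0
  period-*ℕ {a} {b} p (suc n) =
    subst₂ (HasPeriod τ) (sym (suc-* (+ n) a)) (sym (suc-* (+ n) b)) (period-+ p (period-*ℕ p n))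

  period-* : ∀ {a b} → HasPeriod τ a b → ∀ k → HasPeriod τ (k * a) (k * b)
  period-* p (+ n)     = period-*ℕ p n
  period-* {a} {b} p -[1+ n ] =
    subst₂ (HasPeriod τ) (neg-distribˡ-* (+ suc n) a) (neg-distribˡ-* (+ suc n) b)
           (period-neg (period-*ℕ p (suc n)))

  SquarePeriod : ℕ → Set
  SquarePeriod n = HasPeriod τ (+ suc n) 0ℤ × HasPeriod τ 0ℤ (+ suc n)

  squarePeriod : ∀ {p q} → HasPeriod τ (+ suc p) 0ℤ → HasPeriod τ 0ℤ (+ suc q) →
                 ∃ SquarePeriod
  squarePeriod {p} {q} horizontal vertical = _ ,
    subst₂ (HasPeriod τ) (trans (*-comm (+ suc q) (+ suc p)) (sym (pos-* (suc p) (suc q))))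
                         (*-zeroʳ (+ suc q)) (period-* horizontal (+ suc q)) ,
    subst₂ (HasPeriod τ) (*-zeroʳ (+ suc p)) (sym (pos-* (suc p) (suc q)))
                         (period-* vertical (+ suc p))

  -- (q + 1)·(a, h + 1) − a·(q + 1, 0) = (0, (q + 1)(h + 1))
  twoPeriods⇒square : ∀ {q a h} → HasPeriod τ (+ suc q) 0ℤ → HasPeriod τ a (+ suc h) →
                       ∃ SquarePeriod
  twoPeriods⇒square {q} {a} {h} horizontal oblique = squarePeriod horizontal
    (subst₂ (HasPeriod τ) (cancel (+ suc q) a) height
      (period-+ (period-* oblique (+ suc q)) (period-* horizontal (- a))))
    where
    cancel : ∀ q a → q * a + (- a) * q ≡ 0ℤ
    cancel = solve-∀
    height : + suc q * + suc h + (- a) * 0ℤ ≡ + suc (h ℕ.+ q ℕ.* suc h)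
    height = trans (cong (_+_ (+ suc q * + suc h)) (*-zeroʳ (- a)))
                   (trans (+-identityʳ _) (sym (pos-* (suc q) (suc h))))

flipTile : Prototile → Prototile
flipTile t = ⟨ bottom t , right t , upper t , left t ⟩

transposeWith : ∀ {S S'} → (∀ {t} → t ∈ S → flipTile t ∈ S') → Tiling S → Tiling S'
T      (transposeWith flip∈ τ) x y = flipTile (T τ y x)
inS    (transposeWith flip∈ τ) x y = flip∈ (inS τ y x)
matchH (transposeWith flip∈ τ) x y = matchV τ y x
matchV (transposeWith flip∈ τ) x y = matchH τ y x

unflip∈ : ∀ {t} → t ∈ map flipTile S → flipTile t ∈ S
unflip∈ t∈ with ∈-map⁻ flipTile t∈
... | s , s∈S , refl = s∈S

transpose : Tiling S → Tiling (map flipTile S)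
transpose = transposeWith (∈-map⁺ flipTile)

untranspose : Tiling (map flipTile S) → Tiling S
untranspose = transposeWith unflip∈

module _ {S S'} (flip∈ : ∀ {t} → t ∈ S → flipTile t ∈ S') (τ : Tiling S) where

  transposeWith-period : ∀ {a b} → HasPeriod τ a b → HasPeriod (transposeWith flip∈ τ) b a
  transposeWith-period p x y = cong flipTile (p y x)

  transposeWith-squarePeriod : ∀ {n} → SquarePeriod τ n → SquarePeriod (transposeWith flip∈ τ) n
  transposeWith-squarePeriod (horizontal , vertical) =
    transposeWith-period vertical , transposeWith-period horizontal

module _ {A : Set} {F : ℤ → A} {g : ℤ → ℤ} {m : ℕ}
         (step : ∀ z {j} → - + m ℤ.≤ j → j ℤ.≤ + m → F (g (z + 1ℤ) + j) ≡ F (g z + 1ℤ + j))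
         where

  window : ∀ z {i} → i ℕ.≤ m → ∀ {j} → - + m ℤ.≤ j → j + + i ℤ.≤ + m →
           F (g (z + + i) + j) ≡ F (g z + (+ i + j))
  window z {zero} _ {j} _ _ =
    cong F (cong₂ _+_ (cong g (+-identityʳ z)) (sym (+-identityˡ j)))
  window z {suc i} i<m {j} -m≤j j+i+1≤m = begin
    F (g (z + + suc i) + j)      ≡⟨ cong (λ w → F (g w + j)) (+-suc-assoc z (+ i)) ⟩
    F (g (z + + i + 1ℤ) + j)     ≡⟨ step (z + + i) -m≤j (≤-trans (i≤i+j j (+ suc i)) j+i+1≤m) ⟩
    F (g (z + + i) + 1ℤ + j)     ≡⟨ cong F (+-assoc (g (z + + i)) 1ℤ j) ⟩
    F (g (z + + i) + (1ℤ + j))   ≡⟨ window z (ℕP.<⇒≤ i<m) (≤-trans -m≤j (i≤j+i j 1ℤ))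
                                      (subst (ℤ._≤ + m) (+-suc-comm j (+ i)) j+i+1≤m) ⟩
    F (g z + (+ i + (1ℤ + j)))   ≡⟨ cong (λ w → F (g z + w)) (+-assoc-suc (+ i) j) ⟩
    F (g z + (+ suc i + j))      ∎
    where
    open ≡-Reasoning
    +-suc-assoc : ∀ z i → z + (1ℤ + i) ≡ z + i + 1ℤ
    +-suc-assoc = solve-∀
    +-suc-comm : ∀ j i → j + (1ℤ + i) ≡ 1ℤ + j + i
    +-suc-comm = solve-∀
    +-assoc-suc : ∀ i j → i + (1ℤ + j) ≡ 1ℤ + i + j
    +-assoc-suc = solve-∀

  window-shift : ∀ {a} → ℤ.∣ a ∣ ≡ m → ∀ x → F (g (x - a)) ≡ F (g x - a)
  window-shift {+ n} refl x = begin
    F (g (x - + n))                    ≡⟨ cong F (plus-cancel (g (x - + n)) (+ n)) ⟨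
    F (g (x - + n) + (+ n - + n))      ≡⟨ window (x - + n) ℕP.≤-refl ≤-refl -n+n≤n ⟨
    F (g (x - + n + + n) - + n)        ≡⟨ cong (λ w → F (g w - + n)) (minus-plus x (+ n)) ⟩
    F (g x - + n)                      ∎
    where
    open ≡-Reasoning
    plus-cancel : ∀ y a → y + (a - a) ≡ y
    plus-cancel = solve-∀
    -n+n≤n : - + n + + n ℤ.≤ + n
    -n+n≤n = subst (ℤ._≤ + n) (sym (+-inverseˡ (+ n))) (ℤ.+≤+ z≤n)
  window-shift { -[1+ n ]} refl x = begin
    F (g (x + + suc n))                ≡⟨ cong F (+-identityʳ _) ⟨
    F (g (x + + suc n) + 0ℤ)           ≡⟨ window x ℕP.≤-refl neg-≤-pos (≤-reflexive refl) ⟩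
    F (g x + (+ suc n + 0ℤ))           ≡⟨ cong (λ w → F (g x + w)) (+-identityʳ _) ⟩
    F (g x + + suc n)                  ∎
    where open ≡-Reasoning

-- A horizontal strip of height h + 1 whose top row fits under its own bottom row
-- shifted by a; stacking shifted copies of it tiles the plane.
record Strip (S : TileSet) (a : ℤ) (h : ℕ) : Set where
  field
    σ      : ℤ → ℕ → Prototile
    σ∈S    : ∀ z r → σ z r ∈ S
    matchH : ∀ z {r} → r ℕ.≤ h → right (σ z r) ≡ left (σ (z + 1ℤ) r)
    matchV : ∀ z {r} → r ℕ.< h → upper (σ z r) ≡ bottom (σ z (suc r))
    wrap   : ∀ z → upper (σ z h) ≡ bottom (σ (z - a) 0)

module _ {a h} (strip : Strip S a h) where
  open Strip strip using (σ)

  stack : Tiling S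
  T      stack x y = σ (x - (y /ℕ suc h) * a) (y %ℕ suc h)
  inS    stack x y = Strip.σ∈S strip _ _
  matchH stack x y =
    trans (Strip.matchH strip (x - k * a) (ℕP.≤-pred (n%ℕd<d y (suc h))))
          (cong (λ w → left (σ w (y %ℕ suc h))) (sym (plus-minus-comm x 1ℤ (k * a))))
    where k = y /ℕ suc h
  matchV stack x y with %ℕ-/ℕ-+1 (suc h) y
  ... | inj₁ (r+1<h+1 , r+1 , k) rewrite r+1 | k =
    Strip.matchV strip (x - (y /ℕ suc h) * a) (ℕP.≤-pred r+1<h+1)
  ... | inj₂ (r+1≡h+1 , r+1 , k+1) rewrite r+1 | k+1 | ℕP.suc-injective r+1≡h+1 =
    trans (Strip.wrap strip (x - k * a))
          (cong (λ w → bottom (σ w 0)) (minus-assoc x k a))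
    where
    k = y /ℕ suc h
    minus-assoc : ∀ x k a → x - k * a - a ≡ x - (k + 1ℤ) * a
    minus-assoc = solve-∀

  stack-period : HasPeriod stack a (+ suc h)
  stack-period x y rewrite proj₁ (%ℕ-/ℕ-+d (suc h) y) | proj₂ (%ℕ-/ℕ-+d (suc h) y) =
    cong (λ w → σ w (y %ℕ suc h)) (shift-cancel x (y /ℕ suc h) a)
    where
    shift-cancel : ∀ x k a → x + a - (k + 1ℤ) * a ≡ x - k * a
    shift-cancel = solve-∀

  stack-horizontalPeriod : ∀ {p} → (∀ z r → σ (z + p) r ≡ σ z r) → HasPeriod stack p 0ℤ
  stack-horizontalPeriod {p} σ-period x y rewrite +-identityʳ y =
    trans (cong (λ w → σ w (y %ℕ suc h)) (plus-minus-comm x p ((y /ℕ suc h) * a)))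
          (σ-period _ _)

module _ {a h} (τ : Tiling S) (oblique : HasPeriod τ a (+ suc h)) where
  private
    m = ℤ.∣ a ∣

    column : ℤ → ℕ → Prototile
    column x r = T τ x (+ r)

    blockColumn : ℤ → ℕ → List Prototile
    blockColumn z k = applyUpTo (column (z + (+ k - + m))) (suc h)

    -- Pumping windows of 2|a| + 1 columns keeps columns up to |a| apart compatible,
    -- which is what the wrap-around condition of the strip relates.
    block : ℤ → List (List Prototile)
    block z = applyUpTo (blockColumn z) (suc m ℕ.+ m)

    block∈ : ∀ z → block z ∈ wordsOf (wordsOf S (suc h)) (suc m ℕ.+ m)
    block∈ z = applyUpTo∈wordsOf {f = blockColumn z} (suc m ℕ.+ m) λ {k} _ →
               applyUpTo∈wordsOf {f = column (z + (+ k - + m))} (suc h) λ _ → inS τ _ _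

    pumped : ∃ λ q → Σ (ℤ → ℤ) (IsLoop block q)
    pumped = pumping block block∈

    g : ℤ → ℤ
    g = proj₁ (proj₂ pumped)

    g-loop : IsLoop block (proj₁ pumped) g
    g-loop = proj₂ (proj₂ pumped)

    columns-agree : ∀ z {j r} → - + m ℤ.≤ j → j ℤ.≤ + m → r ℕ.< suc h →
                    column (g (z + 1ℤ) + j) r ≡ column (g z + 1ℤ + j) r
    columns-agree z {j} -m≤j j≤m r<h+1 =
      subst (λ i → column (g (z + 1ℤ) + i) _ ≡ column (g z + 1ℤ + i) _) k-m≡j
        (applyUpTo-≡⇒≡ {f = column (g (z + 1ℤ) + (+ k - + m))} {column (g z + 1ℤ + (+ k - + m))}
          (applyUpTo-≡⇒≡ {f = blockColumn (g (z + 1ℤ))} {blockColumn (g z + 1ℤ)}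
                         (proj₂ g-loop z)
                         (∣i+m∣<n+m -m≤j (≤-<-trans j≤m (ℤ.+<+ (ℕP.n<1+n m)))))
          r<h+1)
      where
      k = ℤ.∣ j + + m ∣
      k-m≡j : + k - + m ≡ j
      k-m≡j = trans (cong (_- + m) (+∣i+m∣≡i+m -m≤j)) (plus-minus j (+ m))

    columns-agree₀ : ∀ z {r} → r ℕ.< suc h → column (g (z + 1ℤ)) r ≡ column (g z + 1ℤ) r
    columns-agree₀ z {r} r<h+1 =
      subst₂ (λ x y → column x r ≡ column y r) (+-identityʳ _) (+-identityʳ _)
             (columns-agree z (neg-≤-pos {m} {0}) (ℤ.+≤+ z≤n) r<h+1)

    strip : Strip S a h
    Strip.σ      strip z r = column (g z) r
    Strip.σ∈S    strip z r = inS τ _ _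
    Strip.matchH strip z r≤h =
      trans (matchH τ (g z) _) (cong left (sym (columns-agree₀ z (ℕ.s≤s r≤h))))
    Strip.matchV strip z {r} _ =
      trans (matchV τ (g z) (+ r)) (cong (λ y → bottom (T τ (g z) (+ y))) (ℕP.+-comm r 1))
    Strip.wrap   strip z = trans (matchV τ (g z) (+ h)) (cong bottom (begin
      T τ (g z) (+ h + 1ℤ)              ≡⟨ cong (λ y → T τ (g z) (+ y)) (ℕP.+-comm h 1) ⟩
      column (g z) (suc h)              ≡⟨ cong (λ x → T τ x (+ suc h)) (minus-plus (g z) a) ⟨
      T τ (g z - a + a) (0ℤ + + suc h)  ≡⟨ oblique (g z - a) 0ℤ ⟩
      column (g z - a) 0                ≡⟨ bottom-row-shift ⟨
      column (g (z - a)) 0              ∎))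
      where
      open ≡-Reasoning
      bottom-rows-agree : ∀ z {j} → - + m ℤ.≤ j → j ℤ.≤ + m →
                          column (g (z + 1ℤ) + j) 0 ≡ column (g z + 1ℤ + j) 0
      bottom-rows-agree z -m≤j j≤m = columns-agree z -m≤j j≤m (s≤s z≤n)
      bottom-row-shift : column (g (z - a)) 0 ≡ column (g z - a) 0
      bottom-row-shift = window-shift {F = λ x → column x 0} {g} bottom-rows-agree refl z

  obliquePeriod⇒squarePeriod : ∃₂ λ (τ' : Tiling S) n → SquarePeriod τ' n
  obliquePeriod⇒squarePeriod = stack strip , twoPeriods⇒square (stack strip)
    (stack-horizontalPeriod strip (λ z r → cong (λ x → column x r) (proj₁ g-loop z)))
    (stack-period strip)

horizontalPeriod⇒squarePeriod : ∀ (τ : Tiling S) {a} → HasPeriod τ (+ suc a) 0ℤ →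
                                 ∃₂ λ (τ' : Tiling S) n → SquarePeriod τ' n
horizontalPeriod⇒squarePeriod τ p =
  let τ' , n , square =
        obliquePeriod⇒squarePeriod (transpose τ) (transposeWith-period (∈-map⁺ flipTile) τ p)
  in untranspose τ' , n , transposeWith-squarePeriod unflip∈ τ' square

periodic⇒squarePeriod : ∀ (τ : Tiling S) → Periodic τ → ∃₂ λ (τ' : Tiling S) n → SquarePeriod τ' n
periodic⇒squarePeriod τ (a        , + suc h  , _ , p) = obliquePeriod⇒squarePeriod τ p
periodic⇒squarePeriod τ (a        , -[1+ h ] , _ , p) =
  obliquePeriod⇒squarePeriod τ (period-neg τ p)
periodic⇒squarePeriod τ (+ suc a  , + 0      , _ , p) = horizontalPeriod⇒squarePeriod τ p
periodic⇒squarePeriod τ (-[1+ a ] , + 0      , _ , p) =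
  horizontalPeriod⇒squarePeriod τ (period-neg τ p)
periodic⇒squarePeriod τ (+ 0      , + 0      , v≢0 , _) = ⊥-elim (v≢0 (refl , refl))

-- Squares and tori

Grid : Set
Grid = List (List Prototile)

-- Row j of a grid is its j-th list; cells outside the grid read as a junk tile.
cell : Grid → ℕ → ℕ → Prototile
cell w i j = nth ⟨ 0 , 0 , 0 , 0 ⟩ (nth [] w j) i

grids : TileSet → ℕ → List Grid
grids S N = wordsOf (wordsOf S N) N

cell∈S : ∀ {N w i j} → w ∈ grids S N → i < N → j < N → cell w i j ∈ S
cell∈S w∈ i<N j<N = nth∈ _ (nth∈ [] w∈ j<N) i<N

gridOf : ℕ → (ℕ → ℕ → Prototile) → Grid
gridOf N f = applyUpTo (λ j → applyUpTo (λ i → f i j) N) N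

gridOf∈grids : ∀ {N f} → (∀ i j → f i j ∈ S) → gridOf N f ∈ grids S N
gridOf∈grids {N = N} {f} f∈S =
  applyUpTo∈wordsOf N λ {j} _ → applyUpTo∈wordsOf {f = λ i → f i j} N λ _ → f∈S _ _

cell-gridOf : ∀ {N f i j} → i < N → j < N → cell (gridOf N f) i j ≡ f i j
cell-gridOf {N} {f} {i} {j} i<N j<N =
  trans (cong (λ row → nth _ row i) (nth-applyUpTo [] (λ j → applyUpTo (λ i → f i j) N) j<N))
        (nth-applyUpTo _ (λ i → f i j) i<N)

ValidSquare : ℕ → Grid → Set
ValidSquare N w = ∀ {i} → i < N → ∀ {j} → j < N →
  (suc i < N → right (cell w i j) ≡ left (cell w (suc i) j)) ×
  (suc j < N → upper (cell w i j) ≡ bottom (cell w i (suc j)))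

ValidTorus : ℕ → Grid → Set
ValidTorus n w = ∀ {i} → i < suc n → ∀ {j} → j < suc n →
  right (cell w i j) ≡ left (cell w (suc i % suc n) j) ×
  upper (cell w i j) ≡ bottom (cell w i (suc j % suc n))

validSquare? : ∀ N w → Dec (ValidSquare N w)
validSquare? N w = ℕP.allUpTo? (λ i → ℕP.allUpTo? (λ j →
  ((suc i <? N) →-dec (right (cell w i j) ℕ.≟ left (cell w (suc i) j))) ×-dec
  ((suc j <? N) →-dec (upper (cell w i j) ℕ.≟ bottom (cell w i (suc j))))) N) N

validTorus? : ∀ n w → Dec (ValidTorus n w)
validTorus? n w = ℕP.allUpTo? (λ i → ℕP.allUpTo? (λ j →
  (right (cell w i j) ℕ.≟ left (cell w (suc i % suc n) j)) ×-dec
  (upper (cell w i j) ℕ.≟ bottom (cell w i (suc j % suc n)))) (suc n)) (suc n)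

SquareTileable : TileSet → ℕ → Set
SquareTileable S N = Any (ValidSquare N) (grids S N)

TorusTileable : TileSet → ℕ → Set
TorusTileable S n = Any (ValidTorus n) (grids S (suc n))

squareTileable? : ∀ S N → Dec (SquareTileable S N)
squareTileable? S N = any? (validSquare? N) (grids S N)

torusTileable? : ∀ S n → Dec (TorusTileable S n)
torusTileable? S n = any? (validTorus? n) (grids S (suc n))

module _ {N : ℕ} {f : ℕ → ℕ → Prototile} where

  gridOf-fitsH : ∀ {i i' j} → i < N → i' < N → j < N → right (f i j) ≡ left (f i' j) →
                 right (cell (gridOf N f) i j) ≡ left (cell (gridOf N f) i' j)
  gridOf-fitsH i<N i'<N j<N =
    subst₂ (λ t t' → right t ≡ left t') (sym (cell-gridOf i<N j<N)) (sym (cell-gridOf i'<N j<N))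

  gridOf-fitsV : ∀ {i j j'} → i < N → j < N → j' < N → upper (f i j) ≡ bottom (f i j') →
                 upper (cell (gridOf N f) i j) ≡ bottom (cell (gridOf N f) i j')
  gridOf-fitsV i<N j<N j'<N =
    subst₂ (λ t t' → upper t ≡ bottom t') (sym (cell-gridOf i<N j<N)) (sym (cell-gridOf i<N j'<N))

module _ (τ : Tiling S) where
  private
    f : ℕ → ℕ → Prototile
    f i j = T τ (+ i) (+ j)

    fitsH : ∀ i j → right (f i j) ≡ left (f (suc i) j)
    fitsH i j = trans (matchH τ (+ i) (+ j)) (cong (λ x → left (T τ (+ x) (+ j))) (ℕP.+-comm i 1))

    fitsV : ∀ i j → upper (f i j) ≡ bottom (f i (suc j))
    fitsV i j = trans (matchV τ (+ i) (+ j)) (cong (λ y → bottom (T τ (+ i) (+ y))) (ℕP.+-comm j 1))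

  tiling⇒squareTileable : ∀ N → SquareTileable S N
  tiling⇒squareTileable N = lose (gridOf∈grids {N = N} {f} λ _ _ → inS τ _ _) valid
    where
    valid : ValidSquare N (gridOf N f)
    valid {i} i<N {j} j<N = (λ i+1<N → gridOf-fitsH {f = f} i<N i+1<N j<N (fitsH i j))
                          , (λ j+1<N → gridOf-fitsV {f = f} i<N j<N j+1<N (fitsV i j))

  squarePeriod⇒torusTileable : ∀ {n} → SquarePeriod τ n → TorusTileable S n
  squarePeriod⇒torusTileable {n} (horizontal , vertical) =
    lose (gridOf∈grids {N = suc n} {f} λ _ _ → inS τ _ _) valid
    where
    valid : ValidTorus n (gridOf (suc n) f)
    valid {i} i<N {j} j<N =
      gridOf-fitsH {f = f} i<N (m%n<n (suc i) (suc n)) j<N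
        (trans (fitsH i j) (cong left (wrapAround (λ k → f k j) columnPeriod i<N))) ,
      gridOf-fitsV {f = f} i<N j<N (m%n<n (suc j) (suc n))
        (trans (fitsV i j) (cong bottom (wrapAround (f i) rowPeriod j<N)))
      where
      columnPeriod : ∀ k → f (k ℕ.+ suc n) j ≡ f k j
      columnPeriod k = trans (cong (T τ _) (sym (+-identityʳ (+ j)))) (horizontal (+ k) (+ j))
      rowPeriod : ∀ k → f i (k ℕ.+ suc n) ≡ f i k
      rowPeriod k =
        trans (cong (λ x → T τ x (+ (k ℕ.+ suc n))) (sym (+-identityʳ (+ i)))) (vertical (+ i) (+ k))

torusTileable⇒periodic : ∀ {n} → TorusTileable S n → ∃ λ (τ : Tiling S) → Periodic τ
torusTileable⇒periodic {S} {n} torus with find torus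
... | w , w∈ , valid = τ , + suc n , 0ℤ , (λ ()) , period
  where
  residue : ℤ → ℕ
  residue x = x %ℕ suc n
  residue< : ∀ x → residue x < suc n
  residue< x = n%ℕd<d x (suc n)
  τ : Tiling S
  T      τ x y = cell w (residue x) (residue y)
  inS    τ x y = cell∈S w∈ (residue< x) (residue< y)
  matchH τ x y rewrite [x+1]%ℕd≡[1+x%ℕd]%d (suc n) x = proj₁ (valid (residue< x) (residue< y))
  matchV τ x y rewrite [x+1]%ℕd≡[1+x%ℕd]%d (suc n) y = proj₂ (valid (residue< x) (residue< y))
  period : ∀ x y → T τ (x + + suc n) (y + 0ℤ) ≡ T τ x y
  period x y rewrite proj₁ (%ℕ-/ℕ-+d (suc n) x) | +-identityʳ y = refl

-- Box tilings and compactness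

Box : ℕ → ℤ → Set
Box m x = - + m ℤ.≤ x × x ℤ.< + m

record BoxTiling (S : TileSet) (m : ℕ) : Set where
  field
    at    : ℤ → ℤ → Prototile
    at∈S  : ∀ {x y} → Box m x → Box m y → at x y ∈ S
    fitsH : ∀ {x y} → Box m x → Box m (x + 1ℤ) → Box m y → right (at x y) ≡ left (at (x + 1ℤ) y)
    fitsV : ∀ {x y} → Box m x → Box m y → Box m (y + 1ℤ) → upper (at x y) ≡ bottom (at x (y + 1ℤ))

module _ {m : ℕ} where
  private
    boxIndex : ℤ → ℕ
    boxIndex x = ℤ.∣ x + + m ∣

    boxIndex< : ∀ {x} → Box m x → boxIndex x < m ℕ.+ m
    boxIndex< (-m≤x , x<m) = ∣i+m∣<n+m -m≤x x<m

    boxIndex-suc : ∀ {x} → Box m x → Box m (x + 1ℤ) → boxIndex (x + 1ℤ) ≡ suc (boxIndex x)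
    boxIndex-suc {x} (-m≤x , _) (-m≤x+1 , _) = +-injective (begin
      + boxIndex (x + 1ℤ)   ≡⟨ +∣i+m∣≡i+m -m≤x+1 ⟩
      x + 1ℤ + + m       ≡⟨ +-suc-comm x (+ m) ⟩
      1ℤ + (x + + m)     ≡⟨ cong (_+_ 1ℤ) (+∣i+m∣≡i+m -m≤x) ⟨
      + suc (boxIndex x)    ∎)
      where
      open ≡-Reasoning
      +-suc-comm : ∀ x m → x + 1ℤ + m ≡ 1ℤ + (x + m)
      +-suc-comm = solve-∀

  squareTileable⇒boxTiling : SquareTileable S (m ℕ.+ m) → BoxTiling S m
  squareTileable⇒boxTiling square with find square
  ... | w , w∈ , valid = record
    { at    = λ x y → cell w (boxIndex x) (boxIndex y)
    ; at∈S  = λ bx by → cell∈S w∈ (boxIndex< bx) (boxIndex< by)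
    ; fitsH = λ {x} {y} bx bx+1 by →
        subst (λ i → right (cell w (boxIndex x) (boxIndex y)) ≡ left (cell w i (boxIndex y)))
              (sym (boxIndex-suc bx bx+1))
              (proj₁ (valid (boxIndex< bx) (boxIndex< by))
                     (subst (_< m ℕ.+ m) (boxIndex-suc bx bx+1) (boxIndex< bx+1)))
    ; fitsV = λ {x} {y} bx by by+1 →
        subst (λ j → upper (cell w (boxIndex x) (boxIndex y)) ≡ bottom (cell w (boxIndex x) j))
              (sym (boxIndex-suc by by+1))
              (proj₂ (valid (boxIndex< bx) (boxIndex< by))
                     (subst (_< m ℕ.+ m) (boxIndex-suc by by+1) (boxIndex< by+1)))
    }

diagonalStep : ℕ × ℕ → ℕ × ℕ
diagonalStep (x , zero)  = 0 , suc x
diagonalStep (x , suc y) = suc x , y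

unpair : ℕ → ℕ × ℕ
unpair zero    = 0 , 0
unpair (suc n) = diagonalStep (unpair n)

unpair-onto : ∀ s x y → x ℕ.+ y ≡ s → ∃ λ n → unpair n ≡ (x , y)
unpair-onto s       zero    zero    _   = 0 , refl
unpair-onto s       (suc x) y       x+y≡s
  with unpair-onto s x (suc y) (trans (ℕP.+-suc x y) x+y≡s)
... | n , eq = suc n , cong diagonalStep eq
unpair-onto (suc s) zero    (suc y) y+1≡s+1
  with unpair-onto s y zero (trans (ℕP.+-identityʳ y) (ℕP.suc-injective y+1≡s+1))
... | n , eq = suc n , cong diagonalStep eq

ℕ↩ℕ×ℕ : ℕ ↩ (ℕ × ℕ)
ℕ↩ℕ×ℕ = mk↩ {to = unpair} {from = λ (x , y) → proj₁ (unpair-onto _ x y refl)}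
             λ { {x , y} refl → proj₂ (unpair-onto _ x y refl) }

ℕ×ℕ↩ℤ : (ℕ × ℕ) ↩ ℤ
ℕ×ℕ↩ℤ = mk↩ {to = λ (a , b) → + a - + b} {from = from} λ { {z} refl → inverse z }
  where
  from : ℤ → ℕ × ℕ
  from (+ a)     = a , 0
  from -[1+ n ] = 0 , suc n
  inverse : ∀ z → + proj₁ (from z) - + proj₂ (from z) ≡ z
  inverse (+ a)     = +-identityʳ (+ a)
  inverse -[1+ n ] = refl

ℕ↩ℤ×ℤ : ℕ ↩ (ℤ × ℤ)
ℕ↩ℤ×ℤ = (ℕ×ℕ↩ℤ ×-↩ ℕ×ℕ↩ℤ) ↩-∘ ((ℕ↩ℕ×ℕ ×-↩ ℕ↩ℕ×ℕ) ↩-∘ ℕ↩ℕ×ℕ)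

∣∣<⇒Box : ∀ {m x} → ℤ.∣ x ∣ < m → Box m x
∣∣<⇒Box {m}     {+ n}     n<m         = neg-≤-pos , ℤ.+<+ n<m
∣∣<⇒Box {suc m} { -[1+ n ]} (s≤s n<m) = ℤ.-≤- (ℕP.<⇒≤ n<m) , ℤ.-<+

Box-mono : ∀ {m n x} → m ≤ n → Box m x → Box n x
Box-mono m≤n (-m≤x , x<m) = ≤-trans (neg-mono-≤ (ℤ.+≤+ m≤n)) -m≤x , <-≤-trans x<m (ℤ.+≤+ m≤n)

boxRadius : List ℤ → ℕ
boxRadius xs = suc (foldr (λ x r → ℤ.∣ x ∣ ⊔ r) 0 xs)

∈⇒Box : ∀ {x} xs → x ∈ xs → Box (boxRadius xs) x
∈⇒Box _ x∈xs = ∣∣<⇒Box (s≤s (bound x∈xs))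
  where
  bound : ∀ {x xs} → x ∈ xs → ℤ.∣ x ∣ ≤ foldr (λ x r → ℤ.∣ x ∣ ⊔ r) 0 xs
  bound (here refl)  = ℕP.m≤m⊔n _ _
  bound (there x∈xs) = ℕP.≤-trans (bound x∈xs) (ℕP.m≤n⊔m _ _)

restrict : ∀ {S m n} → m ≤ n → BoxTiling S n → BoxTiling S m
restrict m≤n b = record
  { at    = at
  ; at∈S  = λ bx by → at∈S (Box-mono m≤n bx) (Box-mono m≤n by)
  ; fitsH = λ bx bx+1 by → fitsH (Box-mono m≤n bx) (Box-mono m≤n bx+1) (Box-mono m≤n by)
  ; fitsV = λ bx by by+1 → fitsV (Box-mono m≤n bx) (Box-mono m≤n by) (Box-mono m≤n by+1)
  }
  where open BoxTiling b

module _ (em : ExcludedMiddle 0ℓ) {S : TileSet} (boxes : ∀ m → BoxTiling S m) where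
  private
    open LeftInverse ℕ↩ℤ×ℤ using ()
      renaming (to to position; from to indexOf; strictlyInverseˡ to position-indexOf)
    open BoxTiling using (at; at∈S; fitsH; fitsV)

    dne = em⇒dne em

    -- The k tiles of a prefix l : Vec Prototile k are meant for positions k - 1, …, 0.
    Agrees : (ℤ → ℤ → Prototile) → ∀ {k} → Vec Prototile k → Set
    Agrees f {zero}  []      = ⊤
    Agrees f {suc k} (t ∷ l) = uncurry f (position k) ≡ t × Agrees f l

    Extendable : ∀ {k} → Vec Prototile k → Set
    Extendable l = ∀ m → Σ (BoxTiling S m) λ b → Agrees (at b) l

    Blocked : ∀ {k} → Vec Prototile k → ℕ → Prototile → Set
    Blocked l m t = ¬ Σ (BoxTiling S m) λ b → Agrees (at b) (t ∷ l)

    Blocked-mono : ∀ {k} {l : Vec Prototile k} {m n t} → m ≤ n → Blocked l m t → Blocked l n t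
    Blocked-mono m≤n blocked (b , agrees) = blocked (restrict m≤n b , agrees)

    -- König's lemma: if every candidate for the next position were blocked beyond some
    -- size, a box tiling beyond all those sizes would contradict extendability.
    extend : ∀ {k} (l : Vec Prototile k) → Extendable l →
             Σ Prototile λ t → t ∈ S × Extendable (t ∷ l)
    extend {k} l extendable = dne λ noExtension →
      let blockedAt : ∀ {t} → t ∈ S → ∃ (λ m → Blocked l m t)
          blockedAt {t} t∈S = dne λ notBlocked → noExtension
            (t , t∈S , λ m → dne λ noBox → notBlocked (m , noBox))
          n , allBlocked = uniformBound Blocked-mono S blockedAt
          (x , y) = position k
          xy = x ∷ y ∷ []
          r = boxRadius xy
          b , agrees = extendable (n ⊔ r)
          bx = Box-mono (ℕP.m≤n⊔m n r) (∈⇒Box xy (here refl))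
          by = Box-mono (ℕP.m≤n⊔m n r) (∈⇒Box xy (there (here refl)))
      in allBlocked (at∈S b bx by) (restrict (ℕP.m≤m⊔n n r) b , refl , agrees)

    prefix : ∀ k → Σ (Vec Prototile k) Extendable
    chosen : ∀ k → Σ Prototile λ t → t ∈ S × Extendable (t ∷ proj₁ (prefix k))

    prefix zero    = [] , λ m → boxes m , tt
    prefix (suc k) = proj₁ (chosen k) ∷ proj₁ (prefix k) , proj₂ (proj₂ (chosen k))

    chosen k = extend (proj₁ (prefix k)) (proj₂ (prefix k))

    tile : ℤ × ℤ → Prototile
    tile p = proj₁ (chosen (indexOf p))

    Agrees⇒≡chosen : ∀ {f k} → Agrees f (proj₁ (prefix k)) → ∀ {n} → n < k →
                     uncurry f (position n) ≡ proj₁ (chosen n)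
    Agrees⇒≡chosen {k = suc k} (fk≡ , agrees) {n} (s≤s n≤k) with ℕP.m≤n⇒m<n∨m≡n n≤k
    ... | inj₁ n<k = Agrees⇒≡chosen agrees n<k
    ... | inj₂ refl = fk≡

    Agrees⇒≡tile : ∀ {f k} → Agrees f (proj₁ (prefix k)) → ∀ {p} → indexOf p < k →
                   uncurry f p ≡ tile p
    Agrees⇒≡tile {f} agrees {p} i<k =
      subst (λ q → uncurry f q ≡ tile p) (position-indexOf p) (Agrees⇒≡chosen agrees i<k)

    agreeingBoxTiling : ∀ m p q →
      Σ (BoxTiling S m) λ b → uncurry (at b) p ≡ tile p × uncurry (at b) q ≡ tile q
    agreeingBoxTiling m p q =
      let b , agrees = proj₂ (prefix (suc (indexOf p ℕ.+ indexOf q))) m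
      in b , Agrees⇒≡tile agrees (s≤s (ℕP.m≤m+n _ _)) , Agrees⇒≡tile agrees (s≤s (ℕP.m≤n+m _ _))

  compactness : Tiling S
  T      compactness x y = tile (x , y)
  inS    compactness x y = proj₁ (proj₂ (chosen (indexOf (x , y))))
  matchH compactness x y =
    let cells = x ∷ x + 1ℤ ∷ y ∷ []
        b , at≡ , at≡′ = agreeingBoxTiling (boxRadius cells) (x , y) (x + 1ℤ , y)
    in trans (cong right (sym at≡))
      (trans (fitsH b (∈⇒Box cells (here refl)) (∈⇒Box cells (there (here refl)))
                      (∈⇒Box cells (there (there (here refl)))))
             (cong left at≡′))
  matchV compactness x y =
    let cells = x ∷ y ∷ y + 1ℤ ∷ []
        b , at≡ , at≡′ = agreeingBoxTiling (boxRadius cells) (x , y) (x , y + 1ℤ)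
    in trans (cong upper (sym at≡))
      (trans (fitsV b (∈⇒Box cells (here refl)) (∈⇒Box cells (there (here refl)))
                      (∈⇒Box cells (there (there (here refl)))))
             (cong bottom at≡′))

does≡true⇒ : ∀ {P : Set} (P? : Dec P) → does P? ≡ true → P
does≡true⇒ (yes p) _ = p

SquareNotTorus : TileSet → ℕ → Set
SquareNotTorus S n = SquareTileable S n × ¬ TorusTileable S n

ATile⇒squareNotTorus : ∀ {S} → ATile S → ∀ n → SquareNotTorus S n
ATile⇒squareNotTorus (τ , aperiodic) n =
  tiling⇒squareTileable τ n ,
  λ torus → let τ' , periodic = torusTileable⇒periodic torus in aperiodic τ' periodic

squareNotTorus⇒ATile : ExcludedMiddle 0ℓ → ∀ {S} → (∀ n → SquareNotTorus S n) → ATile S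
squareNotTorus⇒ATile em h =
  compactness em (λ m → squareTileable⇒boxTiling (proj₁ (h (m ℕ.+ m)))) ,
  λ τ periodic → let τ' , n , square = periodic⇒squarePeriod τ periodic
                 in proj₂ (h n) (squarePeriod⇒torusTileable τ' square)

mainTheorem8 : Π⁰₁ ATile
mainTheorem8 = R , λ em S →
    (λ atile n → dec-true (squareNotTorus? S n) (ATile⇒squareNotTorus atile n))
  , (λ R≡true → squareNotTorus⇒ATile em (λ n → does≡true⇒ (squareNotTorus? S n) (R≡true n)))
  where
  squareNotTorus? : ∀ S n → Dec (SquareNotTorus S n)
  squareNotTorus? S n = squareTileable? S n ×-dec ¬? (torusTileable? S n)
  R : TileSet → ℕ → Bool
  R S n = does (squareNotTorus? S n)
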